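{- Let $A$ be a finite alphabet, $X\in A^m$ a pattern and $W\in A^n$ a text. Run Algorithm FIND with the KMP table, where the branch of the comparison $X[i]\neq W[j]$ has a local 2-bit saturating counter predictor with initial state $\lambda_0\in\{\underline\nu,\nu,\tau,\underline\tau\}$. Then the number of mispredictions caused by the letter comparisons equals the sum of the outputs along the path that starts at $(\varepsilon,\lambda_0)$ and is labeled by $W$ in the product transducer $\mathcal{P}^{\mathrm{kmp}}_X$.
   Context: Algorithm FIND$(X,W,B)$: $i,j,nb\gets0,0,0$; while $j<n$: { while ($i\ge0$ and $X[i]\neq W[j]$): $i\gets B[i]$; $i,j\gets i+1,j+1$; if $i=m$: { $i\gets B[i]$; $nb\gets nb+1$ } }; return $nb$. The "and" is short-circuit. The KMP table is $B[i]=|\mathrm{kmp}_X(\mathrm{pref}(X,i))|$, $|\bot|=-1$, where $\mathrm{kmp}_X(X)$ is the longest strict border of $X$, $\mathrm{kmp}_X(\varepsilon)=\bot$, and for each prefix $u\alpha$ of $X$ ($\alpha\in A$), $\mathrm{kmp}_X(u)$ is the longest strict suffix of $u$ that is also a prefix of $u$ and such that $\mathrm{kmp}_X(u)\alpha$ is not a prefix of $X$ ($\bot$ if none). A strict border of $u$ is a word that is both a strict prefix and a strict suffix of $u$. $Q_X$ is the set of strict prefixes of $X$; $\delta_X(u,\alpha)$ is the longest suffix of $u\alpha$ in $Q_X$. For $u\in Q_X$, $\alpha\in A$, define $s(u,\alpha)\in\{N,T\}^*$ by: $N$ if $u\alpha\in Q_X$ or $u\alpha=X$; $T$ if $u\alpha\notin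 Q_X\cup\{X\}$ and $\mathrm{kmp}_X(u)=\bot$; $T\cdot s(\mathrm{kmp}_X(u),\alpha)$ otherwise. A branch outcome is $T$ (taken) if the condition is true, $N$ otherwise. The 2-bit saturating predictor has states $\underline\nu<\nu<\tau<\underline\tau$; on $T$ it moves one step toward $\underline\tau$, on $N$ one step toward $\underline\nu$ (saturating at the ends); $\underline\nu,\nu$ predict $N$, $\tau,\underline\tau$ predict $T$; a misprediction is an outcome differing from the prediction. For $\lambda$ a predictor state and $s\in\{N,T\}^*$, $\xi(\lambda,s)$ is the state reached after reading $s$ from $\lambda$ and $\mu(\lambda,s)$ the number of mispredictions along this path. $\mathcal{P}^{\mathrm{kmp}}_X$ has state set $Q_X\times\{\underline\nu,\nu,\tau,\underline\tau\}$ and, for each state $(u,\lambda)$ and letter $\alpha$, a transition $(u,\lambda)\xrightarrow{\alpha}(\delta_X(u,\alpha),\xi(\lambda,s(u,\alpha)))$ with output the integer $\mu(\lambda,s(u,\alpha))$. -}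

module Defs where

open import Data.Nat using (ℕ; zero; suc; _+_; _∸_; _⊓_)
import Data.Nat
import Data.Bool
open import Data.Integer using (ℤ; +_; -[1+_])
import Data.Integer
import Data.Maybe
open import Data.Fin using (Fin)
import Data.Fin.Properties as FinP
open import Data.List using (List; []; _∷_; _++_; [_]; length; take; drop; _∷ʳ_)
import Data.List.Properties as ListP
open import Data.Bool using (Bool; true; false; if_then_else_; not; _∧_)
open import Data.Maybe using (Maybe; just; nothing)
open import Data.Product using (_×_; _,_; proj₁; proj₂)
open import Relation.Nullary using (does)

Alph : ℕ → Set
Alph k = Fin k

Word : ℕ → Set
Word k = List (Alph k)

module _ {k : ℕ} where

  _=ᴬ_ : Alph k → Alph k → Bool
  a =ᴬ b = does (a FinP.≟ b)

  _=ᵂ_ : Word k → Word k → Bool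
  u =ᵂ v = does (ListP.≡-dec FinP._≟_ u v)

  isPrefixOf : Word k → Word k → Bool
  isPrefixOf v X = take (length v) X =ᵂ v

  -- X[i] (0-based); nothing if out of range
  at : Word k → ℕ → Maybe (Alph k)
  at []      _       = nothing
  at (a ∷ _) zero    = just a
  at (_ ∷ X) (suc i) = at X i

largestBelow : (ℕ → Bool) → ℕ → Maybe ℕ
largestBelow P zero    = nothing
largestBelow P (suc n) = if P n then just n else largestBelow P n

module _ {k : ℕ} (X : Word k) where

  pref : ℕ → Word k
  pref i = take i X

  -- pref(u,j) is a strict border of u (for j < |u|): prefix of length j = suffix of length j
  isBorderLen : Word k → ℕ → Bool
  isBorderLen u j = take j u =ᵂ drop (length u ∸ j) u

  -- kmp_X(u) for u a prefix of X; nothing represents ⊥.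
  kmp : Word k → Maybe (Word k)
  kmp [] = nothing
  kmp u@(_ ∷ _) with does (ListP.≡-dec FinP._≟_ u X)
  ... | true  = Data.Maybe.map (λ j → take j u)
                  (largestBelow (isBorderLen u) (length u))
  ... | false with at X (length u)
  ...   | nothing = nothing   -- u is not a strict prefix of X (irrelevant case)
  ...   | just α  = Data.Maybe.map (λ j → take j u)
                  (largestBelow (λ j → isBorderLen u j ∧ not (isPrefixOf (take j u ∷ʳ α) X))
                                (length u))

  lenM : Maybe (Word k) → ℤ
  lenM nothing  = -[1+ 0 ]
  lenM (just w) = + length w

  B : ℕ → ℤ
  B i = lenM (kmp (pref i))

  -- Algorithm FIND, recording the outcomes of the branch "X[i] ≠ W[j]"
  -- (true = T = condition true, false = N).  The comparison is only
  -- evaluated when i ≥ 0 (short-circuit "and").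

  -- inner while loop; the fuel argument is only for termination
  -- (B[i] < i, so fuel |X|+1 is always sufficient)
  innerLoop : ℕ → ℤ → Alph k → List Bool × ℤ
  innerLoop zero    i        a = [] , i
  innerLoop (suc f) -[1+ n ] a = [] , -[1+ n ]
  innerLoop (suc f) (+ i)    a with at X i
  ... | nothing = [] , + i    -- out of range: never happens
  ... | just x with x =ᴬ a
  ...   | true  = false ∷ [] , + i
  ...   | false = let r = innerLoop f (B i) a in (true ∷ proj₁ r) , proj₂ r

  afterInner : ℤ → ℤ
  afterInner i' with Data.Integer._+_ i' (+ 1)
  ... | i'' = if does (Data.Integer._≟_ i'' (+ length X)) then B (length X) else i''

  findStep : ℤ → Alph k → List Bool × ℤ
  findStep i a = proj₁ (innerLoop (suc (length X)) i a) , afterInner (proj₂ (innerLoop (suc (length X)) i a))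

  findOutcomesFrom : ℤ → Word k → List Bool
  findOutcomesFrom i []      = []
  findOutcomesFrom i (a ∷ W) = proj₁ (findStep i a) ++ findOutcomesFrom (proj₂ (findStep i a)) W

  findOutcomes : Word k → List Bool
  findOutcomes W = findOutcomesFrom (+ 0) W

-- 2-bit saturating counter: ν̲ < ν < τ < τ̲

data Pred : Set where
  strongN weakN weakT strongT : Pred

predicts : Pred → Bool
predicts strongN = false
predicts weakN   = false
predicts weakT   = true
predicts strongT = true

update : Pred → Bool → Pred
update strongN true  = weakN
update weakN   true  = weakT
update weakT   true  = strongT
update strongT true  = strongT
update strongN false = strongN
update weakN   false = strongN
update weakT   false = weakN
update strongT false = weakT

mispredict : Pred → Bool → ℕ
mispredict l o = if (does (Data.Bool._≟_ (predicts l) o)) then 0 else 1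

ξ : Pred → List Bool → Pred
ξ l []      = l
ξ l (o ∷ s) = ξ (update l o) s

μ : Pred → List Bool → ℕ
μ l []      = 0
μ l (o ∷ s) = mispredict l o + μ (update l o) s

module _ {k : ℕ} (X : Word k) where

  -- δ_X(u,α): longest suffix of uα lying in Q_X (strict prefixes of X)
  δ : Word k → Alph k → Word k
  δ u α with largestBelow (λ j → drop (length (u ∷ʳ α) ∸ j) (u ∷ʳ α) =ᵂ take j X)
                          (suc (length (u ∷ʳ α)) ⊓ length X)
  ... | nothing = []       -- never happens when X ≠ ε
  ... | just j  = drop (length (u ∷ʳ α) ∸ j) (u ∷ʳ α)

  -- s(u,α), with fuel for termination (|kmp_X(u)| < |u|, so fuel |u|+1 suffices)
  sF : ℕ → Word k → Alph k → List Bool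
  sF zero    u α = []
  sF (suc f) u α with isPrefixOf (u ∷ʳ α) X
  ... | true  = false ∷ []
  ... | false with kmp X u
  ...   | nothing = true ∷ []
  ...   | just v  = true ∷ sF f v α

  s : Word k → Alph k → List Bool
  s u α = sF (suc (length u)) u α

  pathOutput : Word k → Pred → Word k → ℕ
  pathOutput u l []      = 0
  pathOutput u l (α ∷ W) = μ l (s u α) + pathOutput (δ u α) (ξ l (s u α)) W

-- FIND keeps i = |u| for the state u ∈ Q_X that 𝒫^kmp_X reaches on the text read so far. On a
-- letter a the inner loop visits p = |u|, B[p], B[B[p]], … and, like the recursion defining s,
-- records exactly s(u,a). Every visited pref(X,p) is a suffix of u such that no suffix of ua longer
-- than p+1 lies in Q_X: a length i+1 skipped by the jump from p to B[p] would make pref(X,i) a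
-- border of pref(X,p) followed by a ≠ X[p], a larger candidate for kmp_X(pref(X,p)). So the loop
-- exits with i+1 = |δ_X(u,a)|, or at ⊥ with δ_X(u,a) = ε, except when ua = X, where B[m] and
-- δ_X(u,a) are both the longest strict border of X. As μ is additive along concatenated outcome
-- sequences, induction on the text gives the theorem.

module Submission where

open import Defs
open import Data.Bool using (Bool; true; false; not; _∧_)
open import Data.Bool.Properties using (¬-not; ∧-conicalˡ)
open import Data.Empty using (⊥-elim)
import Data.Fin.Properties as FinP
open import Data.Integer using (+_; -[1+_])
import Data.Integer as ℤ
import Data.Integer.Properties as ℤP
open import Data.List using (List; []; _∷_; _++_; length; take; drop; _∷ʳ_)
import Data.List.Properties as ListP
open import Data.Maybe using (Maybe; just; nothing)
open import Data.Maybe.Properties using (just-injective)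
import Data.Maybe as Maybe
open import Data.Nat using (ℕ; zero; suc; _+_; _∸_; _⊓_; _≤_; _<_; z≤n; s≤s)
open import Data.Nat.Properties
open import Data.Product using (∃; _×_; _,_; proj₁; proj₂)
open import Data.Sum using (inj₁; inj₂)
open import Function using (_∘_)
open import Relation.Binary using (tri<; tri≈; tri>)
open import Relation.Binary.PropositionalEquality
open import Relation.Nullary using (yes; no)
open import Relation.Nullary.Decidable using (dec-true; dec-false)

module _ {A : Set} where

  length-∷ʳ : (u : List A) (a : A) → length (u ∷ʳ a) ≡ suc (length u)
  length-∷ʳ u a = trans (ListP.length-++ u) (+-comm (length u) 1)

  drop-∷ʳ : ∀ {m} (u : List A) (a : A) → m ≤ length u → drop m (u ∷ʳ a) ≡ drop m u ∷ʳ a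
  drop-∷ʳ {zero}  u       a _             = refl
  drop-∷ʳ {suc m} (_ ∷ u) a (s≤s m≤|u|) = drop-∷ʳ u a m≤|u|

  length-take-≤ : ∀ {p} (X : List A) → p ≤ length X → length (take p X) ≡ p
  length-take-≤ {p} X p≤|X| = trans (ListP.length-take p X) (m≤n⇒m⊓n≡m p≤|X|)

  take-take-≤ : ∀ {i p} (X : List A) → i ≤ p → take i (take p X) ≡ take i X
  take-take-≤ {i} {p} X i≤p = trans (ListP.take-take i p X) (cong (λ n → take n X) (m≤n⇒m⊓n≡m i≤p))

∸-+-∸ : ∀ {m p q} → q ≤ p → p ≤ m → (m ∸ p) + (p ∸ q) ≡ m ∸ q
∸-+-∸ {m} {p} {q} q≤p p≤m = begin
  (m ∸ p) + (p ∸ q) ≡⟨ +-∸-assoc (m ∸ p) q≤p ⟨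
  (m ∸ p) + p ∸ q   ≡⟨ cong (_∸ q) (m∸n+n≡m p≤m) ⟩
  m ∸ q             ∎
  where open ≡-Reasoning

μ-++ : (l : Pred) (os os′ : List Bool) → μ l (os ++ os′) ≡ μ l os + μ (ξ l os) os′
μ-++ l []       os′ = refl
μ-++ l (o ∷ os) os′ = trans (cong (_+_ (mispredict l o)) (μ-++ (update l o) os os′))
                           (sym (+-assoc (mispredict l o) _ _))

data LargestBelow (P : ℕ → Bool) (n : ℕ) : Maybe ℕ → Set where
  none : (∀ i → i < n → P i ≡ false) → LargestBelow P n nothing
  some : ∀ {j} → j < n → P j ≡ true → (∀ i → j < i → i < n → P i ≡ false) →
         LargestBelow P n (just j)

private
  false-below-suc : ∀ {P : ℕ → Bool} {n i} → P n ≡ false → i < suc n →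
                    (i < n → P i ≡ false) → P i ≡ false
  false-below-suc Pn i<1+n below with m≤n⇒m<n∨m≡n (≤-pred i<1+n)
  ... | inj₁ i<n  = below i<n
  ... | inj₂ refl = Pn

  true≢false : true ≢ false
  true≢false ()

largestBelow-spec : (P : ℕ → Bool) (n : ℕ) → LargestBelow P n (largestBelow P n)
largestBelow-spec P zero = none (λ _ ())
largestBelow-spec P (suc n) with P n in Pn
... | true  = some ≤-refl Pn (λ i n<i i<1+n → ⊥-elim (<⇒≱ n<i (≤-pred i<1+n)))
... | false with largestBelow P n | largestBelow-spec P n
...   | _ | none below        = none (λ i i<1+n → false-below-suc Pn i<1+n (below i))
...   | _ | some j<n Pj above = some (m<n⇒m<1+n j<n) Pj
                                   (λ i j<i i<1+n → false-below-suc Pn i<1+n (above i j<i))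

LargestBelow-functional : ∀ {P n m m′} → LargestBelow P n m → LargestBelow P n m′ → m ≡ m′
LargestBelow-functional (none _)       (none _)     = refl
LargestBelow-functional (none below)   (some j<n Pj _) = ⊥-elim (true≢false (trans (sym Pj) (below _ j<n)))
LargestBelow-functional (some j<n Pj _) (none below) = ⊥-elim (true≢false (trans (sym Pj) (below _ j<n)))
LargestBelow-functional (some {j} j<n Pj above) (some {j′} j′<n Pj′ above′) with <-cmp j j′
... | tri< j<j′ _ _ = ⊥-elim (true≢false (trans (sym Pj′) (above j′ j<j′ j′<n)))
... | tri≈ _ refl _ = refl
... | tri> _ _ j′<j = ⊥-elim (true≢false (trans (sym Pj) (above′ j j′<j j<n)))

largestBelow-unique : ∀ {P n m} → LargestBelow P n m → largestBelow P n ≡ m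
largestBelow-unique = LargestBelow-functional (largestBelow-spec _ _)

largestBelow-cong : ∀ {P Q : ℕ → Bool} n → (∀ i → i < n → P i ≡ Q i) →
                    largestBelow P n ≡ largestBelow Q n
largestBelow-cong zero    P≗Q = refl
largestBelow-cong {Q = Q} (suc n) P≗Q rewrite P≗Q n ≤-refl with Q n
... | true  = refl
... | false = largestBelow-cong n (λ i i<n → P≗Q i (m<n⇒m<1+n i<n))

module _ {k : ℕ} where

  ≡⇒=ᵂ : {u v : Word k} → u ≡ v → (u =ᵂ v) ≡ true
  ≡⇒=ᵂ = dec-true (ListP.≡-dec FinP._≟_ _ _)

  ≢⇒=ᵂ-false : {u v : Word k} → u ≢ v → (u =ᵂ v) ≡ false
  ≢⇒=ᵂ-false = dec-false (ListP.≡-dec FinP._≟_ _ _)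

  =ᵂ⇒≡ : {u v : Word k} → (u =ᵂ v) ≡ true → u ≡ v
  =ᵂ⇒≡ {u} {v} u=v with ListP.≡-dec FinP._≟_ u v
  ... | yes u≡v = u≡v
  =ᵂ⇒≡ () | no _

  =ᵂ-sym : (u v : Word k) → (u =ᵂ v) ≡ (v =ᵂ u)
  =ᵂ-sym u v with ListP.≡-dec FinP._≟_ u v
  ... | yes u≡v = sym (≡⇒=ᵂ (sym u≡v))
  ... | no  u≢v = sym (≢⇒=ᵂ-false (u≢v ∘ sym))

  at-defined : (X : Word k) {p : ℕ} → p < length X → ∃ λ x → at X p ≡ just x
  at-defined (x ∷ X) {zero}  _           = x , refl
  at-defined (_ ∷ X) {suc p} (s≤s p<|X|) = at-defined X p<|X|

  take-suc-at : (X : Word k) {p : ℕ} {x : Alph k} → at X p ≡ just x →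
                take (suc p) X ≡ take p X ∷ʳ x
  take-suc-at (_ ∷ X) {zero}  refl    = refl
  take-suc-at (y ∷ X) {suc p} X[p]≡x = cong (y ∷_) (take-suc-at X X[p]≡x)

  record IsStrictPrefix (X u : Word k) : Set where
    field
      prefix : take (length u) X ≡ u
      strict : length u < length X

  take-isStrictPrefix : (X : Word k) {c : ℕ} → c < length X → IsStrictPrefix X (take c X)
  take-isStrictPrefix X c<|X| = record
    { prefix = cong (λ n → take n X) (length-take-≤ X (<⇒≤ c<|X|))
    ; strict = subst (_< length X) (sym (length-take-≤ X (<⇒≤ c<|X|))) c<|X|
    }

  []-isStrictPrefix : {X : Word k} → X ≢ [] → IsStrictPrefix X []
  []-isStrictPrefix {[]}    X≢[] = ⊥-elim (X≢[] refl)
  []-isStrictPrefix {_ ∷ _} _    = record { prefix = refl ; strict = s≤s z≤n }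

  kmp-whole : (X : Word k) → X ≢ [] →
              kmp X X ≡ Maybe.map (λ j → take j X) (largestBelow (isBorderLen X X) (length X))
  kmp-whole []          X≢[] = ⊥-elim (X≢[] refl)
  kmp-whole X@(_ ∷ _) _    rewrite dec-true (ListP.≡-dec FinP._≟_ X X) refl = refl

module _ {k : ℕ} (X : Word k) where

  isPrefixOf-take-∷ʳ : ∀ {p x} (b : Alph k) → p < length X → at X p ≡ just x →
                       isPrefixOf (take p X ∷ʳ b) X ≡ ((take p X ∷ʳ x) =ᵂ (take p X ∷ʳ b))
  isPrefixOf-take-∷ʳ {p} b p<|X| X[p]≡x = cong (_=ᵂ (take p X ∷ʳ b)) (begin
    take (length (take p X ∷ʳ b)) X ≡⟨ cong (λ n → take n X) (length-∷ʳ (take p X) b) ⟩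
    take (suc (length (take p X))) X ≡⟨ cong (λ n → take (suc n) X) (length-take-≤ X (<⇒≤ p<|X|)) ⟩
    take (suc p) X                  ≡⟨ take-suc-at X X[p]≡x ⟩
    take p X ∷ʳ _                   ∎)
    where open ≡-Reasoning

  isPrefixOf-take-∷ʳ-match : ∀ {p b} → p < length X → at X p ≡ just b →
                             isPrefixOf (take p X ∷ʳ b) X ≡ true
  isPrefixOf-take-∷ʳ-match {p} {b} p<|X| X[p]≡b =
    trans (isPrefixOf-take-∷ʳ b p<|X| X[p]≡b) (≡⇒=ᵂ {u = take p X ∷ʳ b} refl)

  isPrefixOf-take-∷ʳ-mismatch : ∀ {p x b} → p < length X → at X p ≡ just x → x ≢ b →
                                isPrefixOf (take p X ∷ʳ b) X ≡ false
  isPrefixOf-take-∷ʳ-mismatch {p} {b = b} p<|X| X[p]≡x x≢b =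
    trans (isPrefixOf-take-∷ʳ b p<|X| X[p]≡x)
          (≢⇒=ᵂ-false (x≢b ∘ proj₂ ∘ ListP.∷ʳ-injective (take p X) (take p X)))

  kmpCandidate : Word k → Alph k → ℕ → Bool
  kmpCandidate v x j = isBorderLen X v j ∧ not (isPrefixOf (take j v ∷ʳ x) X)

  kmp-unfold : ∀ {v x n} → length v ≡ suc n → v ≢ X → at X (suc n) ≡ just x →
               kmp X v ≡ Maybe.map (λ j → take j v) (largestBelow (kmpCandidate v x) (suc n))
  kmp-unfold {v@(_ ∷ _)} refl v≢X X[|v|]≡x with ListP.≡-dec FinP._≟_ v X
  ... | yes v≡X = ⊥-elim (v≢X v≡X)
  ... | no  _   rewrite X[|v|]≡x = refl

  kmp-strictPrefix : ∀ {p x} → p < length X → at X p ≡ just x →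
    ∃ λ m → LargestBelow (kmpCandidate (take p X) x) p m ×
            kmp X (take p X) ≡ Maybe.map (λ j → take j X) m
  kmp-strictPrefix {zero}  _ _ = nothing , none (λ _ ()) , refl
  kmp-strictPrefix {suc p} {x} p<|X| X[p]≡x
    with largestBelow (kmpCandidate v x) (suc p) | largestBelow-spec (kmpCandidate v x) (suc p)
       | kmp-unfold {v} |v|≡ (λ v≡X → <⇒≢ p<|X| (trans (sym |v|≡) (cong length v≡X))) X[p]≡x
    where
    v = take (suc p) X
    |v|≡ : length v ≡ suc p
    |v|≡ = length-take-≤ X (<⇒≤ p<|X|)
  ... | nothing | largest              | kmp≡ = nothing , largest , kmp≡
  ... | just q  | largest@(some q<p _ _) | kmp≡ =
    just q , largest , trans kmp≡ (cong just (take-take-≤ X (<⇒≤ q<p)))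

  B-defined : ∀ p {q} → q ≤ length X → kmp X (take p X) ≡ just (take q X) → B X p ≡ + q
  B-defined _ q≤|X| kmp≡ = trans (cong (lenM X) kmp≡) (cong +_ (length-take-≤ X q≤|X|))

  innerLoop-match : ∀ {f p a} → at X p ≡ just a → innerLoop X (suc f) (+ p) a ≡ (false ∷ [] , + p)
  innerLoop-match {a = a} X[p]≡a rewrite X[p]≡a | dec-true (a FinP.≟ a) refl = refl

  innerLoop-mismatch : ∀ {f p x a i} → at X p ≡ just x → x ≢ a → B X p ≡ i →
    innerLoop X (suc f) (+ p) a ≡ (true ∷ proj₁ (innerLoop X f i a) , proj₂ (innerLoop X f i a))
  innerLoop-mismatch {x = x} {a} X[p]≡x x≢a refl rewrite X[p]≡x | dec-false (x FinP.≟ a) x≢a = refl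

  innerLoop-⊥ : ∀ f a → innerLoop X f -[1+ 0 ] a ≡ ([] , -[1+ 0 ])
  innerLoop-⊥ zero    a = refl
  innerLoop-⊥ (suc f) a = refl

  afterInner-⊥ : 0 < length X → afterInner X -[1+ 0 ] ≡ + 0
  afterInner-⊥ 0<|X| rewrite dec-false (+ 0 ℤ.≟ + length X) (<⇒≢ 0<|X| ∘ ℤP.+-injective) = refl

  afterInner-step : ∀ {p} → suc p ≢ length X → afterInner X (+ p) ≡ + suc p
  afterInner-step {p} ¬last
    rewrite +-comm p 1 | dec-false (+ suc p ℤ.≟ + length X) (¬last ∘ ℤP.+-injective) = refl

  afterInner-last : ∀ {p} → suc p ≡ length X → afterInner X (+ p) ≡ B X (length X)
  afterInner-last {p} last rewrite +-comm p 1 | dec-true (+ suc p ℤ.≟ + length X) (cong +_ last) = refl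

  sF-extends : ∀ {g a} (v : Word k) → isPrefixOf (v ∷ʳ a) X ≡ true → sF X (suc g) v a ≡ false ∷ []
  sF-extends _ extends rewrite extends = refl

  sF-⊥ : ∀ {g a} (v : Word k) → isPrefixOf (v ∷ʳ a) X ≡ false → kmp X v ≡ nothing →
         sF X (suc g) v a ≡ true ∷ []
  sF-⊥ _ ¬extends kmp≡ rewrite ¬extends | kmp≡ = refl

  sF-kmp : ∀ {g v′ a} (v : Word k) → isPrefixOf (v ∷ʳ a) X ≡ false → kmp X v ≡ just v′ →
           sF X (suc g) v a ≡ true ∷ sF X g v′ a
  sF-kmp _ ¬extends kmp≡ rewrite ¬extends | kmp≡ = refl

  innerLoop-outcomes : ∀ {f g p} (a : Alph k) → p < f → p < g → p < length X →
                       proj₁ (innerLoop X f (+ p) a) ≡ sF X g (take p X) a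
  innerLoop-outcomes {suc f} {suc g} {p} a (s≤s p<f) (s≤s p<g) p<|X| with at-defined X p<|X|
  ... | x , X[p]≡x with x FinP.≟ a
  ... | yes refl = trans (cong proj₁ (innerLoop-match X[p]≡x))
                         (sym (sF-extends (take p X) (isPrefixOf-take-∷ʳ-match p<|X| X[p]≡x)))
  ... | no x≢a with kmp-strictPrefix p<|X| X[p]≡x
  ...   | nothing , _ , kmp≡ = begin
    proj₁ (innerLoop X (suc f) (+ p) a)
      ≡⟨ cong proj₁ (innerLoop-mismatch X[p]≡x x≢a (cong (lenM X) kmp≡)) ⟩
    true ∷ proj₁ (innerLoop X f -[1+ 0 ] a)
      ≡⟨ cong (λ r → true ∷ proj₁ r) (innerLoop-⊥ f a) ⟩
    true ∷ []
      ≡⟨ sF-⊥ (take p X) (isPrefixOf-take-∷ʳ-mismatch p<|X| X[p]≡x x≢a) kmp≡ ⟨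
    sF X (suc g) (take p X) a ∎
    where open ≡-Reasoning
  ...   | just q , some q<p _ _ , kmp≡ = begin
    proj₁ (innerLoop X (suc f) (+ p) a)
      ≡⟨ cong proj₁ (innerLoop-mismatch X[p]≡x x≢a (B-defined p (<⇒≤ q<|X|) kmp≡)) ⟩
    true ∷ proj₁ (innerLoop X f (+ q) a)
      ≡⟨ cong (true ∷_) (innerLoop-outcomes a (<-≤-trans q<p p<f) (<-≤-trans q<p p<g) q<|X|) ⟩
    true ∷ sF X g (take q X) a
      ≡⟨ sF-kmp (take p X) (isPrefixOf-take-∷ʳ-mismatch p<|X| X[p]≡x x≢a) kmp≡ ⟨
    sF X (suc g) (take p X) a ∎
    where
    open ≡-Reasoning
    q<|X| : q < length X
    q<|X| = <-trans q<p p<|X|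

module Transition {k : ℕ} (X : Word k) {u : Word k} (u∈Q : IsStrictPrefix X u) (a : Alph k) where

  open IsStrictPrefix u∈Q

  w : Word k
  w = u ∷ʳ a

  suffixTest : ℕ → Bool
  suffixTest j = drop (length w ∸ j) w =ᵂ take j X

  bound : ℕ
  bound = suc (length w) ⊓ length X

  suffix : ℕ → Word k
  suffix j = drop (length u ∸ j) u

  |w|≡ : length w ≡ suc (length u)
  |w|≡ = length-∷ʳ u a

  0<|X| : 0 < length X
  0<|X| = ≤-<-trans z≤n strict

  bound≤|X| : bound ≤ length X
  bound≤|X| = m⊓n≤n (suc (length w)) (length X)

  suffixTest-zero : suffixTest 0 ≡ true
  suffixTest-zero = ≡⇒=ᵂ (ListP.drop-all (length w) w ≤-refl)

  suffixTest-suc : ∀ {i} → i ≤ length u → suffixTest (suc i) ≡ ((suffix i ∷ʳ a) =ᵂ take (suc i) X)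
  suffixTest-suc {i} i≤|u| = cong (_=ᵂ take (suc i) X) (begin
    drop (length w ∸ suc i) w ≡⟨ cong (λ n → drop (n ∸ suc i) w) |w|≡ ⟩
    drop (length u ∸ i) w     ≡⟨ drop-∷ʳ u a (m∸n≤m (length u) i) ⟩
    suffix i ∷ʳ a             ∎)
    where open ≡-Reasoning

  suffixTest-suc⁺ : ∀ {i} → i ≤ length u → take i X ≡ suffix i → at X i ≡ just a →
                    suffixTest (suc i) ≡ true
  suffixTest-suc⁺ {i} i≤|u| isSuffix X[i]≡a = trans (suffixTest-suc i≤|u|) (≡⇒=ᵂ (begin
    suffix i ∷ʳ a  ≡⟨ cong (_∷ʳ a) isSuffix ⟨
    take i X ∷ʳ a  ≡⟨ take-suc-at X X[i]≡a ⟨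
    take (suc i) X ∎))
    where open ≡-Reasoning

  suffixTest-suc⁻ : ∀ {i} → i ≤ length u → suffixTest (suc i) ≡ true →
                    take i X ≡ suffix i × at X i ≡ just a
  suffixTest-suc⁻ {i} i≤|u| passes with at-defined X (≤-<-trans i≤|u| strict)
  ... | y , X[i]≡y
    with ListP.∷ʳ-injective (suffix i) (take i X)
           (trans (=ᵂ⇒≡ (trans (sym (suffixTest-suc i≤|u|)) passes)) (take-suc-at X X[i]≡y))
  ... | suffix≡ , refl = sym suffix≡ , X[i]≡y

  δ-longest : ∀ {c} → LargestBelow suffixTest bound (just c) → δ X u a ≡ take c X
  δ-longest largest@(some _ passes _) rewrite largestBelow-unique largest = =ᵂ⇒≡ passes

  length-δ : ∀ {c} → LargestBelow suffixTest bound (just c) → length (δ X u a) ≡ c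
  length-δ largest@(some c<bound _ _) =
    trans (cong length (δ-longest largest)) (length-take-≤ X (<⇒≤ (<-≤-trans c<bound bound≤|X|)))

  longest-exists : ∃ λ c → LargestBelow suffixTest bound (just c)
  longest-exists with largestBelow suffixTest bound | largestBelow-spec suffixTest bound
  ... | nothing | none fails = ⊥-elim (true≢false (trans (sym suffixTest-zero) (fails 0 0<bound)))
    where
    0<bound : 0 < bound
    0<bound = ⊓-glb (s≤s z≤n) 0<|X|
  ... | just c  | largest    = c , largest

  δ-isStrictPrefix : IsStrictPrefix X (δ X u a)
  δ-isStrictPrefix with longest-exists
  ... | c , largest@(some c<bound _ _) = subst (IsStrictPrefix X) (sym (δ-longest largest))
                                           (take-isStrictPrefix X (<-≤-trans c<bound bound≤|X|))

  suffix-of-suffix : ∀ {p q} → q ≤ p → p ≤ length u → take p X ≡ suffix p →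
                     drop (length (take p X) ∸ q) (take p X) ≡ suffix q
  suffix-of-suffix {p} {q} q≤p p≤|u| isSuffix = begin
    drop (length (take p X) ∸ q) (take p X) ≡⟨ cong (λ n → drop (n ∸ q) (take p X)) |take-p| ⟩
    drop (p ∸ q) (take p X)                 ≡⟨ cong (drop (p ∸ q)) isSuffix ⟩
    drop (p ∸ q) (suffix p)                 ≡⟨ ListP.drop-drop (length u ∸ p) (p ∸ q) u ⟩
    drop (length u ∸ p + (p ∸ q)) u         ≡⟨ cong (λ n → drop n u) (∸-+-∸ q≤p p≤|u|) ⟩
    suffix q                                ∎
    where
    open ≡-Reasoning
    |take-p| : length (take p X) ≡ p
    |take-p| = length-take-≤ X (≤-trans p≤|u| (<⇒≤ strict))

  border⇒suffix : ∀ {p q} → q ≤ p → p ≤ length u → take p X ≡ suffix p →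
                  isBorderLen X (take p X) q ≡ true → take q X ≡ suffix q
  border⇒suffix {p} {q} q≤p p≤|u| isSuffix isBorder = begin
    take q X                                ≡⟨ take-take-≤ X q≤p ⟨
    take q (take p X)                       ≡⟨ =ᵂ⇒≡ isBorder ⟩
    drop (length (take p X) ∸ q) (take p X) ≡⟨ suffix-of-suffix q≤p p≤|u| isSuffix ⟩
    suffix q                                ∎
    where open ≡-Reasoning

  suffix⇒border : ∀ {p q} → q ≤ p → p ≤ length u → take p X ≡ suffix p →
                  take q X ≡ suffix q → isBorderLen X (take p X) q ≡ true
  suffix⇒border {p} {q} q≤p p≤|u| isSuffix q-isSuffix = ≡⇒=ᵂ (begin
    take q (take p X)                       ≡⟨ take-take-≤ X q≤p ⟩
    take q X                                ≡⟨ q-isSuffix ⟩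
    suffix q                                ≡⟨ suffix-of-suffix q≤p p≤|u| isSuffix ⟨
    drop (length (take p X) ∸ q) (take p X) ∎)
    where open ≡-Reasoning

  record LoopInvariant (p : ℕ) : Set where
    field
      bounded    : p ≤ length u
      isSuffix   : take p X ≡ suffix p
      longerFail : ∀ j → suc p < j → j < bound → suffixTest j ≡ false

    p<|X| : p < length X
    p<|X| = ≤-<-trans bounded strict

  invariant-start : LoopInvariant (length u)
  invariant-start = record
    { bounded    = ≤-refl
    ; isSuffix   = trans prefix (cong (λ n → drop n u) (sym (n∸n≡0 (length u))))
    ; longerFail = λ j |w|<j j<bound →
        ⊥-elim (<⇒≱ |w|<j (subst (j ≤_) |w|≡ (≤-pred (≤-trans j<bound (m⊓n≤m _ _)))))
    }

  match-longest : ∀ {p} → LoopInvariant p → at X p ≡ just a → suc p ≢ length X →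
                  LargestBelow suffixTest bound (just (suc p))
  match-longest inv X[p]≡a ¬last =
    some (⊓-glb (s≤s (subst (_ ≤_) (sym |w|≡) (s≤s bounded))) (≤∧≢⇒< p<|X| ¬last))
         (suffixTest-suc⁺ bounded isSuffix X[p]≡a) longerFail
    where open LoopInvariant inv

  B-last : ∀ {p} → LoopInvariant p → at X p ≡ just a → suc p ≡ length X →
           B X (length X) ≡ + length (δ X u a)
  B-last {p} inv X[p]≡a last with longest-exists
  ... | c , largest = begin
    B X (length X)
      ≡⟨ cong (lenM X ∘ kmp X) (ListP.take-all (length X) X ≤-refl) ⟩
    lenM X (kmp X X)
      ≡⟨ cong (lenM X) (kmp-whole X X≢[]) ⟩
    lenM X (Maybe.map (λ j → take j X) (largestBelow (isBorderLen X X) (length X)))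
      ≡⟨ cong (lenM X ∘ Maybe.map (λ j → take j X)) (trans borders≡ (largestBelow-unique largest)) ⟩
    + length (take c X)
      ≡⟨ cong (+_ ∘ length) (δ-longest largest) ⟨
    + length (δ X u a) ∎
    where
    open ≡-Reasoning
    open LoopInvariant inv
    X≢[] : X ≢ []
    X≢[] X≡[] = <⇒≢ 0<|X| (sym (cong length X≡[]))
    p≡|u| : p ≡ length u
    p≡|u| = ≤-antisym bounded (≤-pred (subst (length u <_) (sym last) strict))
    u≡ : u ≡ take p X
    u≡ = sym (begin
      take p X                     ≡⟨ isSuffix ⟩
      drop (length u ∸ p) u        ≡⟨ cong (λ n → drop (length u ∸ n) u) p≡|u| ⟩
      drop (length u ∸ length u) u ≡⟨ cong (λ n → drop n u) (n∸n≡0 (length u)) ⟩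
      u                            ∎)
    w≡X : w ≡ X
    w≡X = begin
      u ∷ʳ a         ≡⟨ cong (_∷ʳ a) u≡ ⟩
      take p X ∷ʳ a  ≡⟨ take-suc-at X X[p]≡a ⟨
      take (suc p) X ≡⟨ ListP.take-all (suc p) X (≤-reflexive (sym last)) ⟩
      X              ∎
    bound≡ : bound ≡ length X
    bound≡ = trans (cong (λ v → suc (length v) ⊓ length X) w≡X) (m≥n⇒m⊓n≡n (n≤1+n (length X)))
    borders≡ : largestBelow (isBorderLen X X) (length X) ≡ largestBelow suffixTest bound
    borders≡ = trans (largestBelow-cong (length X) λ j _ →
                        trans (=ᵂ-sym (take j X) (drop (length X ∸ j) X))
                              (cong (λ v → drop (length v ∸ j) v =ᵂ take j X) (sym w≡X)))
                     (cong (largestBelow suffixTest) (sym bound≡))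

  module Mismatch {p x} (inv : LoopInvariant p) (X[p]≡x : at X p ≡ just x) (x≢a : x ≢ a) where

    open LoopInvariant inv

    shorter-extension-is-candidate : ∀ {i} → i < p → suffixTest (suc i) ≡ true →
                                     kmpCandidate X (take p X) x i ≡ true
    shorter-extension-is-candidate {i} i<p passes = cong₂ (λ b e → b ∧ not e) isBorder ¬extends
      where
      extension : take i X ≡ suffix i × at X i ≡ just a
      extension = suffixTest-suc⁻ (≤-trans (<⇒≤ i<p) bounded) passes
      isBorder : isBorderLen X (take p X) i ≡ true
      isBorder = suffix⇒border (<⇒≤ i<p) bounded isSuffix (proj₁ extension)
      ¬extends : isPrefixOf (take i (take p X) ∷ʳ x) X ≡ false
      ¬extends = subst (λ v → isPrefixOf (v ∷ʳ x) X ≡ false) (sym (take-take-≤ X (<⇒≤ i<p)))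
                   (isPrefixOf-take-∷ʳ-mismatch X (<-trans i<p p<|X|) (proj₂ extension) (x≢a ∘ sym))

    longerFail-after : ∀ {lo} → (∀ i → lo ≤ i → i < p → kmpCandidate X (take p X) x i ≡ false) →
                       ∀ j → lo < j → j < bound → suffixTest j ≡ false
    longerFail-after noCandidate (suc i) (s≤s lo≤i) j<bound with <-cmp i p
    ... | tri< i<p _ _ = ¬-not λ passes →
            true≢false (trans (sym (shorter-extension-is-candidate i<p passes)) (noCandidate i lo≤i i<p))
    ... | tri≈ _ refl _ = ¬-not λ passes →
            x≢a (just-injective (trans (sym X[p]≡x) (proj₂ (suffixTest-suc⁻ bounded passes))))
    ... | tri> _ _ p<i = longerFail (suc i) (s≤s p<i) j<bound

    invariant-fallback : ∀ {q} → LargestBelow (kmpCandidate X (take p X) x) p (just q) → LoopInvariant q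
    invariant-fallback (some q<p candidate above) = record
      { bounded    = ≤-trans (<⇒≤ q<p) bounded
      ; isSuffix   = border⇒suffix (<⇒≤ q<p) bounded isSuffix (∧-conicalˡ _ _ candidate)
      ; longerFail = longerFail-after above
      }

    empty-longest : (∀ i → i < p → kmpCandidate X (take p X) x i ≡ false) →
                    LargestBelow suffixTest bound (just 0)
    empty-longest noCandidate =
      some (⊓-glb (s≤s z≤n) 0<|X|) suffixTest-zero (longerFail-after (λ i _ → noCandidate i))

  innerLoop-nextState : ∀ {f p} → p < f → LoopInvariant p →
                        afterInner X (proj₂ (innerLoop X f (+ p) a)) ≡ + length (δ X u a)
  innerLoop-nextState {suc f} {p} (s≤s p<f) inv with at-defined X (LoopInvariant.p<|X| inv)
  ... | x , X[p]≡x with x FinP.≟ a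
  ... | yes refl rewrite innerLoop-match X {f = f} X[p]≡x with suc p ≟ length X
  ...   | yes last = trans (afterInner-last X last) (B-last inv X[p]≡x last)
  ...   | no ¬last = trans (afterInner-step X ¬last)
                           (cong +_ (sym (length-δ (match-longest inv X[p]≡x ¬last))))
  innerLoop-nextState {suc f} {p} (s≤s p<f) inv | x , X[p]≡x | no x≢a
    with kmp-strictPrefix X (LoopInvariant.p<|X| inv) X[p]≡x
  ... | nothing , none noCandidate , kmp≡ = begin
    afterInner X (proj₂ (innerLoop X (suc f) (+ p) a))
      ≡⟨ cong (afterInner X ∘ proj₂) (innerLoop-mismatch X X[p]≡x x≢a (cong (lenM X) kmp≡)) ⟩
    afterInner X (proj₂ (innerLoop X f -[1+ 0 ] a))
      ≡⟨ cong (afterInner X ∘ proj₂) (innerLoop-⊥ X f a) ⟩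
    afterInner X -[1+ 0 ]
      ≡⟨ afterInner-⊥ X 0<|X| ⟩
    + 0
      ≡⟨ cong +_ (length-δ (empty-longest noCandidate)) ⟨
    + length (δ X u a) ∎
    where
    open ≡-Reasoning
    open Mismatch inv X[p]≡x x≢a
  ... | just q , largest@(some q<p _ _) , kmp≡ = begin
    afterInner X (proj₂ (innerLoop X (suc f) (+ p) a))
      ≡⟨ cong (afterInner X ∘ proj₂) (innerLoop-mismatch X X[p]≡x x≢a (B-defined X p q≤|X| kmp≡)) ⟩
    afterInner X (proj₂ (innerLoop X f (+ q) a))
      ≡⟨ innerLoop-nextState (<-≤-trans q<p p<f) (invariant-fallback largest) ⟩
    + length (δ X u a) ∎
    where
    open ≡-Reasoning
    open Mismatch inv X[p]≡x x≢a
    q≤|X| : q ≤ length X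
    q≤|X| = <⇒≤ (<-trans q<p (LoopInvariant.p<|X| inv))

findStep-simulates : ∀ {k} (X : Word k) {u} → IsStrictPrefix X u → (a : Alph k) →
                     findStep X (+ length u) a ≡ (s X u a , + length (δ X u a))
findStep-simulates X {u} u∈Q a = cong₂ _,_
  (trans (innerLoop-outcomes X a (s≤s (<⇒≤ strict)) ≤-refl strict)
         (cong (λ v → sF X (suc (length u)) v a) prefix))
  (innerLoop-nextState (s≤s (<⇒≤ strict)) invariant-start)
  where
  open IsStrictPrefix u∈Q
  open Transition X u∈Q a

findOutcomesFrom-pathOutput : ∀ {k} (X W : Word k) {u} (l : Pred) → IsStrictPrefix X u →
                              μ l (findOutcomesFrom X (+ length u) W) ≡ pathOutput X u l W
findOutcomesFrom-pathOutput X []      l u∈Q = refl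
findOutcomesFrom-pathOutput X (a ∷ W) {u} l u∈Q = begin
  μ l (proj₁ (findStep X (+ length u) a) ++ findOutcomesFrom X (proj₂ (findStep X (+ length u) a)) W)
    ≡⟨ cong (λ r → μ l (proj₁ r ++ findOutcomesFrom X (proj₂ r) W)) (findStep-simulates X u∈Q a) ⟩
  μ l (s X u a ++ findOutcomesFrom X (+ length (δ X u a)) W)
    ≡⟨ μ-++ l (s X u a) _ ⟩
  μ l (s X u a) + μ (ξ l (s X u a)) (findOutcomesFrom X (+ length (δ X u a)) W)
    ≡⟨ cong (_+_ (μ l (s X u a))) (findOutcomesFrom-pathOutput X W _ δ-isStrictPrefix) ⟩
  pathOutput X u l (a ∷ W) ∎
  where
  open ≡-Reasoning
  open Transition X u∈Q a using (δ-isStrictPrefix)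

lemma6 : (k : ℕ) (X W : Word k) → X ≢ [] → (l₀ : Pred) →
    μ l₀ (findOutcomes X W) ≡ pathOutput X [] l₀ W
lemma6 k X W X≢[] l₀ = findOutcomesFrom-pathOutput X W l₀ ([]-isStrictPrefix X≢[])
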